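{- Let $u$ and $v$ be vertices belonging to distinct partite sets of a bipartite tournament $D$. Then $u$ and $v$ $(1,2)$-compete in $D$ if and only if $u$ has an out-neighbor different from $v$ and $v$ has an out-neighbor different from $u$.
   Context: A bipartite tournament is an orientation of a complete bipartite graph $K_{m,n}$ ($m,n\ge1$); its partite sets are those of $K_{m,n}$. Vertices $u,v$ of a digraph $D$ $(1,2)$-compete if there is a vertex $w\neq u,v$ such that either there is an arc $(u,w)$ and a directed $(v,w)$-walk of length $2$ not traversing $u$, or there is a directed $(u,w)$-walk of length $2$ not traversing $v$ and an arc $(v,w)$. -}

module Defs where

open import Data.Nat using (ℕ; _≥_)
open import Data.Fin using (Fin)
open import Data.Bool using (Bool; true; false)
open import Data.Sum using (_⊎_; inj₁; inj₂)
open import Data.Product using (_×_; ∃-syntax)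
open import Data.Empty using (⊥)
open import Data.Unit using (⊤)
open import Relation.Nullary using (¬_)
open import Relation.Binary.PropositionalEquality using (_≡_)

record Digraph (V : Set) : Set₁ where
  field
    Arc : V → V → Set

open Digraph public

Walk2Avoiding : {V : Set} → Digraph V → V → V → V → Set
Walk2Avoiding D a b c =
  ¬ (a ≡ c) × ¬ (b ≡ c) × ∃[ x ] (Arc D a x × Arc D x b × ¬ (x ≡ c))

Compete12 : {V : Set} → Digraph V → V → V → Set
Compete12 D u v = ∃[ w ] (¬ (w ≡ u) × ¬ (w ≡ v) ×
  ((Arc D u w × Walk2Avoiding D v w u) ⊎ (Walk2Avoiding D u w v × Arc D v w)))

-- Bipartite tournament: orientation of K_{m,n}; partite sets are Fin m (inj₁)
-- and Fin n (inj₂).  orient i j = true means arc i → j, false means j → i.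
record BipartiteTournament (m n : ℕ) : Set where
  field
    orient : Fin m → Fin n → Bool

BTArc : {m n : ℕ} → BipartiteTournament m n → Fin m ⊎ Fin n → Fin m ⊎ Fin n → Set
BTArc T (inj₁ i) (inj₂ j) = BipartiteTournament.orient T i j ≡ true
BTArc T (inj₂ j) (inj₁ i) = BipartiteTournament.orient T i j ≡ false
BTArc T (inj₁ _) (inj₁ _) = ⊥
BTArc T (inj₂ _) (inj₂ _) = ⊥

toDigraph : {m n : ℕ} → BipartiteTournament m n → Digraph (Fin m ⊎ Fin n)
toDigraph T = record { Arc = BTArc T }

DistinctParts : {m n : ℕ} → Fin m ⊎ Fin n → Fin m ⊎ Fin n → Set
DistinctParts (inj₁ _) (inj₂ _) = ⊤
DistinctParts (inj₂ _) (inj₁ _) = ⊤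
DistinctParts _ _ = ⊥

HasOutNbrOtherThan : {V : Set} → Digraph V → V → V → Set
HasOutNbrOtherThan D u v = ∃[ x ] (Arc D u x × ¬ (x ≡ v))

-- An out-neighbour a ≠ v of u and an out-neighbour b ≠ u of v lie in the
-- partite sets of v and u respectively, so they are joined by an arc.  If
-- a → b, then u → a → b together with v → b makes u and v (1,2)-compete at
-- b; if b → a, the symmetric configuration does so at a.
module Submission where

open import Defs
open import Data.Nat using (ℕ; _≥_)
open import Data.Fin using (Fin)
open import Data.Sum using (_⊎_; inj₁; inj₂; [_,_])
open import Data.Product using (_×_; _,_)
open import Data.Bool using (true; false)
open import Data.Unit using (tt)
open import Function.Bundles using (_⇔_; mk⇔)
open import Relation.Nullary using (¬_)
open import Relation.Binary.PropositionalEquality using (_≢_; refl; sym; subst; ≢-sym)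

Loopless : {V : Set} → Digraph V → Set
Loopless D = ∀ {x} → ¬ Arc D x x

module _ {V : Set} (D : Digraph V) where

  arc⇒≢ : Loopless D → ∀ {x y} → Arc D x y → x ≢ y
  arc⇒≢ loopless {x} xy x≡y = loopless (subst (Arc D x) (sym x≡y) xy)

  compete12-sym : ∀ {u v} → Compete12 D u v → Compete12 D v u
  compete12-sym (w , w≢u , w≢v , inj₁ (uw , vwu)) = w , w≢v , w≢u , inj₂ (vwu , uw)
  compete12-sym (w , w≢u , w≢v , inj₂ (uwv , vw)) = w , w≢v , w≢u , inj₁ (vw , uwv)

  compete12⇒outNbrs : ∀ {u v} → Compete12 D u v
                    → HasOutNbrOtherThan D u v × HasOutNbrOtherThan D v u
  compete12⇒outNbrs (w , w≢u , w≢v , inj₁ (uw , _ , _ , x , vx , _ , x≢u)) =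
    (w , uw , w≢v) , (x , vx , x≢u)
  compete12⇒outNbrs (w , w≢u , w≢v , inj₂ ((_ , _ , x , ux , _ , x≢v) , vw)) =
    (x , ux , x≢v) , (w , vw , w≢u)

  compete12-viaPath : Loopless D → ∀ {u v a b} → u ≢ v
                    → Arc D u a → a ≢ v → Arc D a b → Arc D v b → b ≢ u
                    → Compete12 D u v
  compete12-viaPath loopless {v = v} {b = b} u≢v ua a≢v ab vb b≢u =
    _ , b≢u , b≢v , inj₂ ((u≢v , b≢v , _ , ua , ab , a≢v) , vb)
    where
    b≢v : b ≢ v
    b≢v = ≢-sym (arc⇒≢ loopless vb)

module _ {m n : ℕ} where

  distinctParts⇒≢ : {x y : Fin m ⊎ Fin n} → DistinctParts x y → x ≢ y
  distinctParts⇒≢ {inj₁ _} {inj₂ _} _ ()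
  distinctParts⇒≢ {inj₂ _} {inj₁ _} _ ()

  distinctParts-across : {x y a b : Fin m ⊎ Fin n} → DistinctParts x y
                       → DistinctParts x a → DistinctParts y b → DistinctParts a b
  distinctParts-across {inj₁ _} {inj₂ _} {inj₂ _} {inj₁ _} _ _ _ = tt
  distinctParts-across {inj₂ _} {inj₁ _} {inj₁ _} {inj₂ _} _ _ _ = tt

module _ {m n : ℕ} (T : BipartiteTournament m n) where

  private
    D = toDigraph T

  btArc-loopless : Loopless D
  btArc-loopless {inj₁ _} ()
  btArc-loopless {inj₂ _} ()

  btArc-distinctParts : ∀ {x y} → Arc D x y → DistinctParts x y
  btArc-distinctParts {inj₁ _} {inj₂ _} _ = tt
  btArc-distinctParts {inj₂ _} {inj₁ _} _ = tt

  btArc-total : ∀ {x y} → DistinctParts x y → Arc D x y ⊎ Arc D y x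
  btArc-total {inj₁ i} {inj₂ j} _ with BipartiteTournament.orient T i j
  ... | true  = inj₁ refl
  ... | false = inj₂ refl
  btArc-total {inj₂ j} {inj₁ i} _ with BipartiteTournament.orient T i j
  ... | true  = inj₂ refl
  ... | false = inj₁ refl

  outNbrs⇒compete12 : ∀ {u v} → DistinctParts u v
                    → HasOutNbrOtherThan D u v × HasOutNbrOtherThan D v u
                    → Compete12 D u v
  outNbrs⇒compete12 {u} {v} uv ((a , ua , a≢v) , (b , vb , b≢u)) =
    [ (λ ab → compete12-viaPath D btArc-loopless u≢v ua a≢v ab vb b≢u)
    , (λ ba → compete12-sym D
                (compete12-viaPath D btArc-loopless (≢-sym u≢v) vb b≢u ba ua a≢v))
    ] (btArc-total (distinctParts-across uv (btArc-distinctParts ua) (btArc-distinctParts vb)))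
    where
    u≢v : u ≢ v
    u≢v = distinctParts⇒≢ uv

theorem2p4 : (m n : ℕ) → m ≥ 1 → n ≥ 1 → (T : BipartiteTournament m n)
    → (u v : Fin m ⊎ Fin n) → DistinctParts u v
    → Compete12 (toDigraph T) u v
    ⇔ (HasOutNbrOtherThan (toDigraph T) u v × HasOutNbrOtherThan (toDigraph T) v u)
theorem2p4 _ _ _ _ T u v uv =
  mk⇔ (compete12⇒outNbrs (toDigraph T)) (outNbrs⇒compete12 T uv)
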